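{- For every positive integer $k$, $\mathsf{cr}(\mathrm{TC}_k)\ge k$.
   Context: Cycle rank $\mathsf{cr}(G)$: $0$ if $G$ is acyclic; $1+\min_{v\in V(G)}\mathsf{cr}(G-v)$ if $G$ is strongly connected with at least one edge; otherwise the maximum cycle rank over the strongly connected components of $G$. The tree chain $\mathrm{TC}_k$ with terminals $s_k,t_k$: $\mathrm{TC}_0$ is a single vertex $v$ with $s_0=t_0=v$; for $i\ge1$, $\mathrm{TC}_i$ is obtained from two disjoint copies $(B^1,s^1,t^1)$ and $(B^2,s^2,t^2)$ of $(\mathrm{TC}_{i-1},s_{i-1},t_{i-1})$ by adding the edges $(s^1,t^2)$ and $(s^2,t^1)$, and setting $s_i=s^1$, $t_i=t^2$. -}

module Defs where

open import Data.Nat using (ℕ; zero; suc; _+_; _⊔_; _⊓_)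
open import Data.Bool using (Bool; true; false; _∧_; _∨_; not; if_then_else_)
open import Data.Fin using (Fin; splitAt; _↑ˡ_; _↑ʳ_)
open import Data.Fin.Properties using (_≟_)
open import Data.Sum using (inj₁; inj₂)
open import Data.List using (List; []; _∷_; foldr; map; filter; length)
open import Data.Bool.ListAction using (any; all)
open import Data.List using (allFin)
open import Relation.Nullary.Decidable using (⌊_⌋)

record Digraph : Set where
  field
    n : ℕ
    E : Fin n → Fin n → Bool
open Digraph public

VSet : ℕ → Set
VSet n = Fin n → Bool

eqb : ∀ {n} → Fin n → Fin n → Bool
eqb i j = ⌊ i ≟ j ⌋

module _ (G : Digraph) where
  private
    N = n G
    vs : List (Fin N)
    vs = allFin N

  anyV : (Fin N → Bool) → Bool
  anyV p = any p vs

  allV : (Fin N → Bool) → Bool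
  allV p = all p vs

  -- vertices of S reachable from u by a path (possibly of length 0)
  -- inside the induced subgraph G[S]; computed by n rounds of expansion
  reachStep : VSet N → VSet N → VSet N
  reachStep S R w = R w ∨ (S w ∧ anyV (λ x → R x ∧ E G x w))

  iter : ℕ → (VSet N → VSet N) → VSet N → VSet N
  iter zero f R = R
  iter (suc m) f R = iter m f (f R)

  reach : VSet N → Fin N → Fin N → Bool
  reach S u v = iter N (reachStep S) (λ w → S u ∧ eqb u w) v

  -- G[S] contains a directed cycle (a self-loop counts as a cycle)
  hasCycle : VSet N → Bool
  hasCycle S = anyV (λ u → anyV (λ w → S u ∧ S w ∧ E G u w ∧ reach S w u))

  acyclic : VSet N → Bool
  acyclic S = not (hasCycle S)

  hasEdge : VSet N → Bool
  hasEdge S = anyV (λ u → anyV (λ w → S u ∧ S w ∧ E G u w))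

  stronglyConnected : VSet N → Bool
  stronglyConnected S = allV (λ u → allV (λ v → not (S u ∧ S v) ∨ reach S u v))

  scc : VSet N → Fin N → VSet N
  scc S v w = S v ∧ reach S v w ∧ reach S w v

  remove : VSet N → Fin N → VSet N
  remove S v w = S w ∧ not (eqb v w)

  maxL : List ℕ → ℕ
  maxL = foldr _⊔_ 0

  minL : List ℕ → ℕ
  minL [] = 0
  minL (x ∷ xs) = foldr _⊓_ x xs

  valsOn : VSet N → (Fin N → ℕ) → List ℕ
  valsOn S f = map f (filter (λ v → S v Data.Bool.≟ true) vs)

  -- The fuel argument is only for termination: with fuel ≥ |S| it is
  -- never exhausted, since every recursive call is on a strictly
  -- smaller vertex set (G - v, or a proper SCC of a non-strongly-connected graph).
  crAux : ℕ → VSet N → ℕ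
  crAux zero S = 0
  crAux (suc f) S =
    if acyclic S then 0
    else if stronglyConnected S ∧ hasEdge S
      then suc (minL (valsOn S (λ v → crAux f (remove S v))))
      else maxL (valsOn S (λ v → crAux f (scc S v)))

cr : Digraph → ℕ
cr G = crAux G (n G) (λ _ → true)

tcSize : ℕ → ℕ
tcSize zero = 1
tcSize (suc k) = tcSize k + tcSize k

record TCData (k : ℕ) : Set where
  field
    edge : Fin (tcSize k) → Fin (tcSize k) → Bool
    s t  : Fin (tcSize k)
open TCData public

tcData : (k : ℕ) → TCData k
tcData zero = record { edge = λ _ _ → false ; s = Fin.zero ; t = Fin.zero }
tcData (suc k) = record { edge = e ; s = s₀ ↑ˡ m ; t = m ↑ʳ t₀ }
  where
    m = tcSize k
    D = tcData k
    e₀ = edge D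
    s₀ = s D
    t₀ = t D
    e : Fin (m + m) → Fin (m + m) → Bool
    e i j with splitAt m i | splitAt m j
    ... | inj₁ a | inj₁ b = e₀ a b
    ... | inj₂ a | inj₂ b = e₀ a b
    ... | inj₁ a | inj₂ b = eqb a s₀ ∧ eqb b t₀
    ... | inj₂ a | inj₁ b = eqb a s₀ ∧ eqb b t₀

TC : ℕ → Digraph
TC k = record { n = tcSize k ; E = edge (tcData k) }

-- If the tree chain TC j embeds (injectively, preserving edges) into the
-- induced subgraph G[S], then the cycle rank of G[S] is at least j.  The
-- image of TC (j + 1) is strongly connected and has an edge, so G[S] has a
-- cycle.  If G[S] is strongly connected, deleting any vertex v misses one of
-- the two copies of TC j, which therefore embeds into G[S] − v.  Otherwise
-- the image lies in one strongly connected component, a proper subset of S.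
-- Induction on |S| (the fuel of crAux) concludes; the theorem is the case of
-- the identity embedding of TC k into itself.
module Submission where

open import Defs
open import Data.Nat using (ℕ; zero; suc; _≤_; _<_; z≤n; s≤s; _+_)
open import Data.Nat.Properties
  using (≤-refl; ≤-trans; ≤-antisym; <-≤-trans; ≤-pred; m≤n⇒m≤n⊔o; m≤n⇒m≤o⊔n; ⊓-glb)
open import Data.Bool using (Bool; true; false; _∧_; _∨_; not)
open import Data.Bool.Properties using (∧-conicalˡ; ∧-conicalʳ; ¬-not)
import Data.Bool.Properties as Bool
open import Data.Fin using (Fin; _↑ˡ_; _↑ʳ_; splitAt)
open import Data.Fin.Properties
  using (_≟_; all?; any?; ¬∀⟶∃¬; splitAt-↑ˡ; splitAt-↑ʳ; splitAt⁻¹-↑ˡ; splitAt⁻¹-↑ʳ;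
         ↑ˡ-injective; ↑ʳ-injective)
import Data.Fin.Subset as Subset
open import Data.Fin.Subset.Properties using (p⊂q⇒∣p∣<∣q∣; ∣p∣≤n; ∣p∣≡n⇒p≡⊤; ∈⊤)
open import Data.List using (_∷_; allFin)
open import Data.List.Properties using (map-cong; foldr-preservesᵇ; foldr-preservesᵒ)
open import Data.List.Relation.Unary.All as All using (All; _∷_)
import Data.List.Relation.Unary.All.Properties as Allₚ
open import Data.List.Relation.Unary.Any using (here; there)
open import Data.List.Membership.Propositional using (_∈_; lose)
open import Data.List.Membership.Propositional.Properties using (∈-allFin; ∈-filter⁺; ∈-map⁺)
open import Data.Bool.ListAction using (any; all; or)
open import Data.Vec using (tabulate)
open import Data.Vec.Properties using (lookup∘tabulate; []=⇒lookup; lookup⇒[]=)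
open import Data.Product using (∃; _×_; _,_; proj₁; proj₂)
open import Data.Sum using (_⊎_; inj₁; inj₂; [_,_])
open import Function using (_∘_; case_of_)
open import Relation.Nullary using (yes; no; contradiction)
open import Relation.Binary.PropositionalEquality hiding ([_])

eqb-refl : ∀ {n} (i : Fin n) → eqb i i ≡ true
eqb-refl i with i ≟ i
... | yes _  = refl
... | no i≢i = contradiction refl i≢i

eqb⇒≡ : ∀ {n} {i j : Fin n} → eqb i j ≡ true → i ≡ j
eqb⇒≡ {i = i} {j} with i ≟ j
... | yes i≡j = λ _ → i≡j

∧-intro : ∀ {a b} → a ≡ true → b ≡ true → a ∧ b ≡ true
∧-intro refl b≡true = b≡true

module _ {A : Set} (p : A → Bool) where

  any-intro : ∀ {x xs} → x ∈ xs → p x ≡ true → any p xs ≡ true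
  any-intro (here refl) px rewrite px = refl
  any-intro {xs = y ∷ _} (there x∈xs) px rewrite any-intro x∈xs px = Bool.∨-zeroʳ (p y)

  any-elim : ∀ xs → any p xs ≡ true → ∃ λ x → p x ≡ true
  any-elim (x ∷ xs) h with p x in px
  ... | true  = x , px
  ... | false = any-elim xs h

  all-elim : ∀ xs → all p xs ≡ false → ∃ λ x → p x ≡ false
  all-elim (x ∷ xs) h with p x in px
  ... | false = x , px
  ... | true  = all-elim xs h

module _ {n : ℕ} where

  infix 4 _⊆_

  _⊆_ : VSet n → VSet n → Set
  S ⊆ T = ∀ x → S x ≡ true → T x ≡ true

  size : VSet n → ℕ
  size S = Subset.∣ tabulate S ∣

  private
    ∈-tabulate⁺ : ∀ {S : VSet n} {x} → S x ≡ true → x Subset.∈ tabulate S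
    ∈-tabulate⁺ {S} {x} Sx = lookup⇒[]= x (tabulate S) (trans (lookup∘tabulate S x) Sx)

    ∈-tabulate⁻ : ∀ {S : VSet n} {x} → x Subset.∈ tabulate S → S x ≡ true
    ∈-tabulate⁻ {S} {x} x∈S = trans (sym (lookup∘tabulate S x)) ([]=⇒lookup x∈S)

    tabulate-⊆ : ∀ {S T : VSet n} → S ⊆ T → tabulate S Subset.⊆ tabulate T
    tabulate-⊆ S⊆T x∈S = ∈-tabulate⁺ (S⊆T _ (∈-tabulate⁻ x∈S))

  size-strict : ∀ {S T : VSet n} x → S ⊆ T → T x ≡ true → S x ≡ false → size S < size T
  size-strict x S⊆T Tx Sx = p⊂q⇒∣p∣<∣q∣ (tabulate-⊆ S⊆T , x , ∈-tabulate⁺ Tx , x∉S)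
    where x∉S = λ x∈S → contradiction (trans (sym (∈-tabulate⁻ x∈S)) Sx) λ ()

  size≤n : ∀ S → size S ≤ n
  size≤n S = ∣p∣≤n (tabulate S)

  size≥n⇒full : ∀ {S : VSet n} → n ≤ size S → ∀ x → S x ≡ true
  size≥n⇒full {S} n≤|S| x =
    ∈-tabulate⁻ (subst (x Subset.∈_) (sym (∣p∣≡n⇒p≡⊤ (≤-antisym (size≤n S) n≤|S|))) ∈⊤)

  size>0 : ∀ {S : VSet n} x → S x ≡ true → 0 < size S
  size>0 x Sx = ≤-trans (s≤s z≤n) (size-strict x (λ _ ()) Sx refl)

module _ (G : Digraph) (f : VSet (n G) → VSet (n G))
         (f-inflationary : ∀ R → R ⊆ f R) (f-cong : ∀ {R R′} → R ≗ R′ → f R ≗ f R′) where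

  iter-suc : ∀ m R → iter G (suc m) f R ≡ f (iter G m f R)
  iter-suc zero    R = refl
  iter-suc (suc m) R = iter-suc m (f R)

  iter-inflationary : ∀ m R → R ⊆ iter G m f R
  iter-inflationary zero    R w Rw = Rw
  iter-inflationary (suc m) R w Rw = iter-inflationary m (f R) w (f-inflationary R w Rw)

  fixed-or-grows : ∀ R → f R ≗ R ⊎ size R < size (f R)
  fixed-or-grows R with all? (λ w → f R w Bool.≟ R w)
  ... | yes fixed = inj₁ fixed
  ... | no ¬fixed with ¬∀⟶∃¬ _ _ (λ w → f R w Bool.≟ R w) ¬fixed
  ...   | w , fRw≢Rw with R w in Rw
  ...     | true  = contradiction (f-inflationary R w Rw) fRw≢Rw
  ...     | false = inj₂ (size-strict w (f-inflationary R) (¬-not fRw≢Rw) Rw)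

  iter-fixed-or-large : ∀ m R → f (iter G m f R) ≗ iter G m f R ⊎ m ≤ size (iter G m f R)
  iter-fixed-or-large zero R = inj₂ z≤n
  iter-fixed-or-large (suc m) R rewrite iter-suc m R with iter-fixed-or-large m R
  ... | inj₁ fixed = inj₁ (f-cong fixed)
  ... | inj₂ m≤size with fixed-or-grows (iter G m f R)
  ...   | inj₁ fixed = inj₁ (f-cong fixed)
  ...   | inj₂ grows = inj₂ (≤-trans (s≤s m≤size) grows)

  iter-fixed : ∀ R → f (iter G (n G) f R) ≗ iter G (n G) f R
  iter-fixed R with iter-fixed-or-large (n G) R
  ... | inj₁ fixed = fixed
  ... | inj₂ large = λ w → trans (f-inflationary _ w (full w)) (sym (full w))
    where full = size≥n⇒full large

module _ (G : Digraph) where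

  private
    N : ℕ
    N = n G

  EdgeClosed : VSet N → VSet N → Set
  EdgeClosed S C = ∀ {x w} → C x ≡ true → S w ≡ true → E G x w ≡ true → C w ≡ true

  module _ (S : VSet N) where

    reachStep-inflationary : ∀ R → R ⊆ reachStep G S R
    reachStep-inflationary R w Rw rewrite Rw = refl

    reachStep-cong : ∀ {R R′} → R ≗ R′ → reachStep G S R ≗ reachStep G S R′
    reachStep-cong R≗R′ w =
      cong₂ (λ a b → a ∨ (S w ∧ b)) (R≗R′ w) (cong or (map-cong (λ x → cong (_∧ E G x w) (R≗R′ x)) (allFin N)))

    reachStep-edge : ∀ R {x w} → R x ≡ true → S w ≡ true → E G x w ≡ true → reachStep G S R w ≡ true
    reachStep-edge R {x} {w} Rx Sw Exw
      rewrite Sw | any-intro (λ y → R y ∧ E G y w) (∈-allFin x) (∧-intro Rx Exw) = Bool.∨-zeroʳ (R w)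

    reachStep-⊆ : ∀ {R C} → EdgeClosed S C → R ⊆ C → reachStep G S R ⊆ C
    reachStep-⊆ {R} closed R⊆C w step with R w in Rw
    ... | true  = R⊆C w Rw
    ... | false with any-elim _ (allFin N) (∧-conicalʳ _ _ step)
    ...   | x , RxExw = closed (R⊆C x (∧-conicalˡ _ _ RxExw)) (∧-conicalˡ _ _ step) (∧-conicalʳ _ _ RxExw)

    iter-reachStep-⊆ : ∀ {C} → EdgeClosed S C → ∀ m {R} → R ⊆ C → iter G m (reachStep G S) R ⊆ C
    iter-reachStep-⊆ closed zero    R⊆C = R⊆C
    iter-reachStep-⊆ closed (suc m) R⊆C = iter-reachStep-⊆ closed m (reachStep-⊆ closed R⊆C)

    reach-closed : ∀ u → EdgeClosed S (reach G S u)
    reach-closed u Rx Sw Exw =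
      trans (sym (iter-fixed G (reachStep G S) reachStep-inflationary reachStep-cong _ _)) (reachStep-edge _ Rx Sw Exw)

    reach-least : ∀ {C} u → EdgeClosed S C → (S u ≡ true → C u ≡ true) → reach G S u ⊆ C
    reach-least {C} u closed Cu = iter-reachStep-⊆ closed N start⊆C
      where
      start⊆C : (λ w → S u ∧ eqb u w) ⊆ C
      start⊆C w h = subst (λ y → C y ≡ true) (eqb⇒≡ (∧-conicalʳ _ _ h)) (Cu (∧-conicalˡ _ _ h))

    reach-refl : ∀ {u} → S u ≡ true → reach G S u u ≡ true
    reach-refl {u} Su =
      iter-inflationary G (reachStep G S) reachStep-inflationary reachStep-cong N _ u (∧-intro Su (eqb-refl u))

    reach-trans : ∀ {u v w} → reach G S u v ≡ true → reach G S v w ≡ true → reach G S u w ≡ true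
    reach-trans {u} {v} u⇝v = reach-least v (reach-closed u) (λ _ → u⇝v) _

    reach-via-edge : ∀ {u x y v} → reach G S u x ≡ true → S y ≡ true → E G x y ≡ true → reach G S y v ≡ true
                   → reach G S u v ≡ true
    reach-via-edge u⇝x Sy Exy = reach-trans (reach-closed _ u⇝x Sy Exy)

    reach-⊆ : ∀ u → reach G S u ⊆ S
    reach-⊆ u = reach-least u (λ _ Sw _ → Sw) (λ Su → Su)

data SplitView (m n : ℕ) : Fin (m + n) → Set where
  inl : ∀ a → SplitView m n (a ↑ˡ n)
  inr : ∀ b → SplitView m n (m ↑ʳ b)

splitView : ∀ m n i → SplitView m n i
splitView m n i with splitAt m i in eq
... | inj₁ a = subst (SplitView m n) (splitAt⁻¹-↑ˡ eq) (inl a)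
... | inj₂ b = subst (SplitView m n) (splitAt⁻¹-↑ʳ eq) (inr b)

↑ˡ≢↑ʳ : ∀ {m n} (a : Fin m) (b : Fin n) → a ↑ˡ n ≢ m ↑ʳ b
↑ˡ≢↑ʳ {m} {n} a b eq with trans (sym (splitAt-↑ˡ m a n)) (trans (cong (splitAt m) eq) (splitAt-↑ʳ m n b))
... | ()

module _ (j : ℕ) where

  private
    m = tcSize j
    D = tcData j

  tc-edge-↑ˡ : ∀ a b → edge (tcData (suc j)) (a ↑ˡ m) (b ↑ˡ m) ≡ edge D a b
  tc-edge-↑ˡ a b rewrite splitAt-↑ˡ m a m | splitAt-↑ˡ m b m = refl

  tc-edge-↑ʳ : ∀ a b → edge (tcData (suc j)) (m ↑ʳ a) (m ↑ʳ b) ≡ edge D a b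
  tc-edge-↑ʳ a b rewrite splitAt-↑ʳ m m a | splitAt-↑ʳ m m b = refl

  tc-edge-s¹t² : edge (tcData (suc j)) (s D ↑ˡ m) (m ↑ʳ t D) ≡ true
  tc-edge-s¹t² rewrite splitAt-↑ˡ m (s D) m | splitAt-↑ʳ m m (t D) | eqb-refl (s D) | eqb-refl (t D) = refl

  tc-edge-s²t¹ : edge (tcData (suc j)) (m ↑ʳ s D) (t D ↑ˡ m) ≡ true
  tc-edge-s²t¹ rewrite splitAt-↑ʳ m m (s D) | splitAt-↑ˡ m (t D) m | eqb-refl (s D) | eqb-refl (t D) = refl

module _ (G : Digraph) where

  private
    N : ℕ
    N = n G

  record TCEmbedding (j : ℕ) (S : VSet N) : Set where
    field
      φ           : Fin (tcSize j) → Fin N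
      φ-injective : ∀ {a b} → φ a ≡ φ b → a ≡ b
      φ-edge      : ∀ {a b} → edge (tcData j) a b ≡ true → E G (φ a) (φ b) ≡ true
      φ-∈         : ∀ a → S (φ a) ≡ true

  open TCEmbedding

  shrink : ∀ {j S T} (e : TCEmbedding j S) → (∀ a → T (φ e a) ≡ true) → TCEmbedding j T
  shrink e T∋ = record { φ = φ e ; φ-injective = φ-injective e ; φ-edge = φ-edge e ; φ-∈ = T∋ }

  module _ {j : ℕ} {S : VSet N} (e : TCEmbedding (suc j) S) where

    private
      m = tcSize j

    first-copy : TCEmbedding j S
    first-copy = record
      { φ           = λ a → φ e (a ↑ˡ m)
      ; φ-injective = ↑ˡ-injective m _ _ ∘ φ-injective e
      ; φ-edge      = λ {a} {b} ab → φ-edge e (trans (tc-edge-↑ˡ j a b) ab)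
      ; φ-∈         = φ-∈ e ∘ (_↑ˡ m)
      }

    second-copy : TCEmbedding j S
    second-copy = record
      { φ           = λ b → φ e (m ↑ʳ b)
      ; φ-injective = ↑ʳ-injective m _ _ ∘ φ-injective e
      ; φ-edge      = λ {a} {b} ab → φ-edge e (trans (tc-edge-↑ʳ j a b) ab)
      ; φ-∈         = φ-∈ e ∘ (m ↑ʳ_)
      }

  reach-image : ∀ {j S} (e : TCEmbedding j S) a b → reach G S (φ e a) (φ e b) ≡ true
  reach-image {zero}  {S} e Fin.zero Fin.zero = reach-refl G S (φ-∈ e Fin.zero)
  reach-image {suc j} {S} e a b with splitView (tcSize j) (tcSize j) a | splitView (tcSize j) (tcSize j) b
  ... | inl a | inl b = reach-image (first-copy e) a b
  ... | inr a | inr b = reach-image (second-copy e) a b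
  ... | inl a | inr b = reach-via-edge G S (reach-image (first-copy e) a (s (tcData j))) (φ-∈ e _)
                          (φ-edge e (tc-edge-s¹t² j)) (reach-image (second-copy e) (t (tcData j)) b)
  ... | inr a | inl b = reach-via-edge G S (reach-image (second-copy e) a (s (tcData j))) (φ-∈ e _)
                          (φ-edge e (tc-edge-s²t¹ j)) (reach-image (first-copy e) (t (tcData j)) b)

  module _ {j : ℕ} {S : VSet N} (e : TCEmbedding (suc j) S) where

    private
      u = φ e (s (tcData j) ↑ˡ tcSize j)
      w = φ e (tcSize j ↑ʳ t (tcData j))
      u→w : E G u w ≡ true
      u→w = φ-edge e (tc-edge-s¹t² j)

    hasEdge-image : hasEdge G S ≡ true
    hasEdge-image = any-intro _ (∈-allFin u) (any-intro _ (∈-allFin w) (∧-intro (φ-∈ e _) (∧-intro (φ-∈ e _) u→w)))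

    hasCycle-image : hasCycle G S ≡ true
    hasCycle-image = any-intro _ (∈-allFin u) (any-intro _ (∈-allFin w)
      (∧-intro (φ-∈ e _) (∧-intro (φ-∈ e _) (∧-intro u→w (reach-image e _ _)))))

  remove-⊆ : ∀ S v → remove G S v ⊆ S
  remove-⊆ S v w = ∧-conicalˡ _ _

  remove-shrinks : ∀ {S v} → S v ≡ true → size (remove G S v) < size S
  remove-shrinks {S} {v} Sv =
    size-strict v (remove-⊆ S v) Sv (trans (cong (λ b → S v ∧ not b) (eqb-refl v)) (Bool.∧-zeroʳ (S v)))

  ∈-remove : ∀ {S v w} → S w ≡ true → v ≢ w → remove G S v w ≡ true
  ∈-remove {v = v} {w} Sw v≢w with v ≟ w
  ... | yes v≡w = contradiction v≡w v≢w
  ... | no _    = ∧-intro Sw refl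

  remove-embedding : ∀ {j S} → TCEmbedding (suc j) S → ∀ v → TCEmbedding j (remove G S v)
  remove-embedding {j} {S} e v with any? (λ a → φ e (a ↑ˡ tcSize j) ≟ v)
  ... | yes (a , φa≡v) = shrink (second-copy e) λ b →
          ∈-remove {S} (φ-∈ e _) λ v≡φb → ↑ˡ≢↑ʳ a b (φ-injective e (trans φa≡v v≡φb))
  ... | no  v∉first    = shrink (first-copy e) λ a →
          ∈-remove {S} (φ-∈ e _) λ v≡φa → v∉first (a , sym v≡φa)

  scc-reach : ∀ {S v w} → scc G S v w ≡ true → reach G S v w ≡ true × reach G S w v ≡ true
  scc-reach {S} {v} {w} h =
    let v⇝w∧w⇝v = ∧-conicalʳ (S v) _ h
    in ∧-conicalˡ (reach G S v w) _ v⇝w∧w⇝v , ∧-conicalʳ (reach G S v w) _ v⇝w∧w⇝v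

  scc-⊆ : ∀ S v → scc G S v ⊆ S
  scc-⊆ S v w = reach-⊆ G S v w ∘ proj₁ ∘ scc-reach

  scc-embedding : ∀ {j S} (e : TCEmbedding j S) x → TCEmbedding j (scc G S (φ e x))
  scc-embedding e x = shrink e λ a → ∧-intro (φ-∈ e x) (∧-intro (reach-image e x a) (reach-image e a x))

  not-strongly-connected⇒unreachable :
    ∀ {S} → stronglyConnected G S ≡ false → ∃ λ a → ∃ λ b → S a ≡ true × S b ≡ true × reach G S a b ≡ false
  not-strongly-connected⇒unreachable {S} ¬sc with all-elim _ (allFin N) ¬sc
  ... | a , ¬a⇝all with all-elim _ (allFin N) ¬a⇝all
  ...   | b , ¬a⇝b =
    let SaSb = Bool.not-injective (Bool.∨-conicalˡ _ _ ¬a⇝b)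
    in a , b , ∧-conicalˡ _ _ SaSb , ∧-conicalʳ _ _ SaSb , Bool.∨-conicalʳ _ _ ¬a⇝b

  scc-shrinks : ∀ {S v} → stronglyConnected G S ≡ false → size (scc G S v) < size S
  scc-shrinks {S} {v} ¬sc with not-strongly-connected⇒unreachable ¬sc
  ... | a , b , Sa , Sb , ¬a⇝b with scc G S v a in Ca | scc G S v b in Cb
  ...   | _     | false = size-strict b (scc-⊆ S v) Sb Cb
  ...   | false | true  = size-strict a (scc-⊆ S v) Sa Ca
  ...   | true  | true  =
    case trans (sym (reach-trans G S (proj₂ (scc-reach Ca)) (proj₁ (scc-reach Cb)))) ¬a⇝b of λ ()

  ≤-minL : ∀ {j y xs} → y ∈ xs → All (j ≤_) xs → j ≤ minL G xs
  ≤-minL {xs = _ ∷ _} _ (j≤x ∷ j≤xs) = foldr-preservesᵇ ⊓-glb j≤x j≤xs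

  ≤-maxL : ∀ {j y xs} → y ∈ xs → j ≤ y → j ≤ maxL G xs
  ≤-maxL {xs = xs} y∈xs j≤y =
    foldr-preservesᵒ (λ x z → [ m≤n⇒m≤n⊔o z , m≤n⇒m≤o⊔n x ]) 0 xs (inj₂ (lose y∈xs j≤y))

  ∈-valsOn : ∀ {S v} (g : Fin N → ℕ) → S v ≡ true → g v ∈ valsOn G S g
  ∈-valsOn {S} {v} g Sv = ∈-map⁺ g (∈-filter⁺ (λ w → S w Bool.≟ true) (∈-allFin v) Sv)

  valsOn-All : ∀ {P : ℕ → Set} S (g : Fin N → ℕ) → (∀ {v} → S v ≡ true → P (g v)) → All P (valsOn G S g)
  valsOn-All S g P = Allₚ.map⁺ (All.map P (Allₚ.all-filter (λ w → S w Bool.≟ true) (allFin N)))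

  crAux-bound : ∀ fuel {j S} → TCEmbedding j S → size S ≤ fuel → j ≤ crAux G fuel S
  crAux-bound fuel       {zero}      _ _ = z≤n
  crAux-bound zero       {suc j} {S} e |S|≤0 =
    contradiction (<-≤-trans (size>0 {S = S} _ (φ-∈ e (s (tcData (suc j))))) |S|≤0) λ ()
  crAux-bound (suc fuel) {suc j} {S} e |S|≤ rewrite hasCycle-image e with stronglyConnected G S in sc
  ... | true rewrite hasEdge-image e = s≤s (≤-minL (∈-valsOn crRemove (φ-∈ e x₀)) (valsOn-All S crRemove ih))
    where
    x₀ = s (tcData (suc j))
    crRemove = λ v → crAux G fuel (remove G S v)
    ih : ∀ {v} → S v ≡ true → j ≤ crRemove v
    ih {v} Sv = crAux-bound fuel (remove-embedding e v) (≤-pred (<-≤-trans (remove-shrinks Sv) |S|≤))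
  ... | false = ≤-trans (crAux-bound fuel (scc-embedding e x₀) (≤-pred (<-≤-trans (scc-shrinks sc) |S|≤)))
                        (≤-maxL (∈-valsOn (λ v → crAux G fuel (scc G S v)) (φ-∈ e x₀)) ≤-refl)
    where x₀ = s (tcData (suc j))

open TCEmbedding

lemma3p3 : (k : ℕ) → 1 ≤ k → k ≤ cr (TC k)
lemma3p3 k _ = crAux-bound (TC k) (tcSize k) identity (size≤n _)
  where
  identity : TCEmbedding (TC k) k (λ _ → true)
  identity = record { φ = λ a → a ; φ-injective = λ eq → eq ; φ-edge = λ e → e ; φ-∈ = λ _ → refl }
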